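{- Let $H$ be a $2$-polar graph and $v$ a vertex of $H$. Then the graph obtained from $H$ by switching on $v$ is also $2$-polar. If, additionally, $H$ is a disconnected cograph, then every partial complement of $H$ is again a $2$-polar cograph, and it is disconnected.
   Context: All graphs are finite and simple. A cograph is a graph with no induced $P_4$. A $2$-polar partition of a graph $G$ is a partition of $V(G)$ into (possibly empty) sets $A,B$ such that $G[A]$ is a complete multipartite graph with at most $2$ parts and $G[B]$ is a disjoint union of at most $2$ cliques with no other edges; $G$ is $2$-polar if it has such a partition. Switching on a vertex $v$ of $H$ produces the graph $H'$ with the same vertex set, in which the neighbourhood of $v$ becomes $V(H) \setminus N_H(v)$ (with $v$ itself excluded, i.e. $v$ becomes adjacent exactly to its former non-neighbours), while all other adjacencies are unchanged. A partial complement of a disconnected graph $H$ is obtained by splitting the set of components of $H$ into two non-empty groups, forming $H'$ and $H''$ as the disjoint unions of the components in each group, and taking $\overline{H'} + \overline{H''}$ (disjoint union of the complements). -}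

module Defs where

open import Data.Nat using (ℕ)
open import Data.Fin using (Fin; _≟_)
open import Data.Bool using (Bool; true; false; not; _∨_; _xor_; if_then_else_)
open import Data.Bool.Properties using (∨-comm)
open import Data.Product using (Σ; _×_; _,_; ∃-syntax)
open import Relation.Nullary using (¬_; yes; no)
open import Relation.Nullary.Decidable using (⌊_⌋)
open import Relation.Binary.PropositionalEquality using (_≡_; _≢_; refl; sym; cong)

record Graph : Set where
  field
    n      : ℕ
    adj    : Fin n → Fin n → Bool
    adj-sym : ∀ x y → adj x y ≡ adj y x
    adj-irrefl : ∀ x → adj x x ≡ false
open Graph public

-- 2-polar partitions
-- side x ≡ true  : x ∈ A,  side x ≡ false : x ∈ B.
-- G[A] complete multipartite with ≤ 2 parts: a labelling p of A into two
--   (possibly empty) independent sets, with all edges between them.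
-- G[B] disjoint union of ≤ 2 cliques (no other edges): a labelling q of B
--   into two (possibly empty) cliques, with no edges between them.
record TwoPolarPartition (G : Graph) : Set where
  field
    side : Fin (n G) → Bool
    p    : Fin (n G) → Bool
    q    : Fin (n G) → Bool
    A-ok : ∀ x y → x ≢ y → side x ≡ true → side y ≡ true →
           adj G x y ≡ (p x xor p y)
    B-ok : ∀ x y → x ≢ y → side x ≡ false → side y ≡ false →
           adj G x y ≡ not (q x xor q y)

TwoPolar : Graph → Set
TwoPolar G = TwoPolarPartition G

IsInducedP4 : (G : Graph) → Fin (n G) → Fin (n G) → Fin (n G) → Fin (n G) → Set
IsInducedP4 G a b c d =
  a ≢ b × a ≢ c × a ≢ d × b ≢ c × b ≢ d × c ≢ d ×
  adj G a b ≡ true × adj G b c ≡ true × adj G c d ≡ true ×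
  adj G a c ≡ false × adj G b d ≡ false × adj G a d ≡ false

Cograph : Graph → Set
Cograph G = ∀ a b c d → ¬ IsInducedP4 G a b c d

data Reachable (G : Graph) : Fin (n G) → Fin (n G) → Set where
  here : ∀ {x} → Reachable G x x
  step : ∀ {x y z} → adj G x y ≡ true → Reachable G y z → Reachable G x z

Connected : Graph → Set
Connected G = ∀ x y → Reachable G x y

Disconnected : Graph → Set
Disconnected G = Σ (Fin (n G)) λ x → Σ (Fin (n G)) λ y → ¬ Reachable G x y

switchAdj : ∀ {m} → (Fin m → Fin m → Bool) → Fin m → Fin m → Fin m → Bool
switchAdj a v x y =
  if ⌊ x ≟ y ⌋ then false
  else (if ⌊ x ≟ v ⌋ ∨ ⌊ y ≟ v ⌋ then not (a x y) else a x y)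

switch : (H : Graph) → Fin (n H) → Graph
switch H v = record
  { n = n H
  ; adj = switchAdj (adj H) v
  ; adj-sym = symP
  ; adj-irrefl = irr
  }
  where
  irr : ∀ x → switchAdj (adj H) v x x ≡ false
  irr x with x ≟ x
  ... | yes _ = refl
  ... | no ne = Data.Empty.⊥-elim (ne refl)
    where import Data.Empty
  symP : ∀ x y → switchAdj (adj H) v x y ≡ switchAdj (adj H) v y x
  symP x y with x ≟ y | y ≟ x
  ... | yes _ | yes _ = refl
  ... | yes e | no ne = Data.Empty.⊥-elim (ne (sym e))
    where import Data.Empty
  ... | no ne | yes e = Data.Empty.⊥-elim (ne (sym e))
    where import Data.Empty
  ... | no _ | no _ rewrite ∨-comm ⌊ x ≟ v ⌋ ⌊ y ≟ v ⌋ | Graph.adj-sym H x y = refl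

-- A split of the set of components into two non-empty groups is given by
-- g : V → Bool constant along edges (hence on components), taking both values.
record ComponentSplit (H : Graph) : Set where
  field
    g        : Fin (n H) → Bool
    closed   : ∀ x y → adj H x y ≡ true → g x ≡ g y
    nonempty₁ : ∃[ x ] g x ≡ true
    nonempty₂ : ∃[ x ] g x ≡ false
open ComponentSplit public

pcAdj : ∀ {m} → (Fin m → Fin m → Bool) → (Fin m → Bool) → Fin m → Fin m → Bool
pcAdj a g x y =
  if ⌊ x ≟ y ⌋ then false
  else (if g x xor g y then false else not (a x y))

partialComplement : (H : Graph) → ComponentSplit H → Graph
partialComplement H s = record
  { n = n H
  ; adj = pcAdj (adj H) (g s)
  ; adj-sym = symP
  ; adj-irrefl = irr
  }
  where
  open import Data.Empty using (⊥-elim)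
  open import Data.Bool.Properties using (xor-comm)
  irr : ∀ x → pcAdj (adj H) (g s) x x ≡ false
  irr x with x ≟ x
  ... | yes _ = refl
  ... | no ne = ⊥-elim (ne refl)
  symP : ∀ x y → pcAdj (adj H) (g s) x y ≡ pcAdj (adj H) (g s) y x
  symP x y with x ≟ y | y ≟ x
  ... | yes _ | yes _ = refl
  ... | yes e | no ne = ⊥-elim (ne (sym e))
  ... | no ne | yes e = ⊥-elim (ne (sym e))
  ... | no _ | no _ rewrite xor-comm (g s x) (g s y) | Graph.adj-sym H x y = refl

module Submission where

-- Call G' the Seidel switch of G by a colouring χ : V → Bool if,
-- for distinct x, y, the adjacency of G' is that of G flipped exactly when
-- χ x ≠ χ y.  Seidel switching preserves 2-polarity: both parity labellings
-- p, q of a 2-polar partition are simply xor-ed with χ.  Complementation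
-- preserves it too, by exchanging the roles of A and B (and of p and q).
-- Both operations of the theorem are of this form:
--   * switching on v is Seidel switching by the indicator of v;
--   * the partial complement for a split g is the Seidel switch of the
--     complement of H by g (inside a group the edges are complemented; the
--     complement joins the two groups completely and switching removes
--     exactly those edges).
-- For the cograph part: an edge of the partial complement never joins the
-- two groups, so an induced P4 in it lies in one group, where the partial
-- complement agrees with the complement of H; and the complement of an
-- induced P4 a-b-c-d is the induced P4 c-a-d-b.  Finally g is constant
-- along paths of the partial complement and takes both values, so the
-- partial complement is disconnected.

open import Defs
open import Data.Fin using (Fin; _≟_)
open import Data.Product using (_×_; _,_; proj₂)
open import Data.Bool using (Bool; true; false; not; _∨_; _xor_; if_then_else_)
open import Data.Bool.Properties
  using (not-involutive; not-distribˡ-xor; xor-comm; xor-same; xor-identityʳ;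
         xor-∧-commutativeRing)
open import Algebra.Bundles using (CommutativeRing)
open import Relation.Nullary using (yes; no; contradiction)
open import Relation.Nullary.Decidable using (⌊_⌋)
open import Relation.Binary.PropositionalEquality
  using (_≡_; _≢_; refl; sym; trans; cong; ≢-sym; module ≡-Reasoning)

open import Algebra.Properties.CommutativeSemigroup
  (CommutativeRing.+-commutativeSemigroup xor-∧-commutativeRing)
  using () renaming (interchange to xor-interchange)

not-move : ∀ {u w} → not u ≡ w → u ≡ not w
not-move {u} e = trans (sym (not-involutive u)) (cong not e)

flip-if : ∀ t b → (if t then not b else b) ≡ b xor t
flip-if true  b = xor-comm true b
flip-if false b = sym (xor-identityʳ b)

off-diagonal : ∀ {m} {x y : Fin m} {b : Bool} → x ≢ y →
               (if ⌊ x ≟ y ⌋ then false else b) ≡ b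
off-diagonal {x = x} {y} x≢y with x ≟ y
... | yes x≡y = contradiction x≡y x≢y
... | no _    = refl

on-vertices-of : (G : Graph) (a : Fin (n G) → Fin (n G) → Bool) →
                 (∀ x y → a x y ≡ a y x) → (∀ x → a x x ≡ false) → Graph
on-vertices-of G a a-sym a-irrefl = record
  { n = n G ; adj = a ; adj-sym = a-sym ; adj-irrefl = a-irrefl }

SeidelSwitch : (G : Graph) → (Fin (n G) → Bool) →
               (Fin (n G) → Fin (n G) → Bool) → Set
SeidelSwitch G χ a' = ∀ x y → x ≢ y → a' x y ≡ adj G x y xor (χ x xor χ y)

module _ (G : Graph) (χ : Fin (n G) → Bool) {a' : Fin (n G) → Fin (n G) → Bool}
         (switched : SeidelSwitch G χ a') where

  seidel-polar : ∀ {a'-sym a'-irrefl} → TwoPolar G →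
                 TwoPolar (on-vertices-of G a' a'-sym a'-irrefl)
  seidel-polar P = record
    { side = side
    ; p    = λ x → p x xor χ x
    ; q    = λ x → q x xor χ x
    ; A-ok = λ x y x≢y sx sy → begin
        a' x y                             ≡⟨ switched x y x≢y ⟩
        adj G x y xor (χ x xor χ y)        ≡⟨ cong (_xor (χ x xor χ y)) (A-ok x y x≢y sx sy) ⟩
        (p x xor p y) xor (χ x xor χ y)    ≡⟨ xor-interchange (p x) (p y) (χ x) (χ y) ⟩
        (p x xor χ x) xor (p y xor χ y)    ∎
    ; B-ok = λ x y x≢y sx sy → begin
        a' x y                             ≡⟨ switched x y x≢y ⟩
        adj G x y xor (χ x xor χ y)        ≡⟨ cong (_xor (χ x xor χ y)) (B-ok x y x≢y sx sy) ⟩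
        not (q x xor q y) xor (χ x xor χ y) ≡⟨ sym (not-distribˡ-xor (q x xor q y) (χ x xor χ y)) ⟩
        not ((q x xor q y) xor (χ x xor χ y)) ≡⟨ cong not (xor-interchange (q x) (q y) (χ x) (χ y)) ⟩
        not ((q x xor χ x) xor (q y xor χ y)) ∎
    }
    where
    open TwoPolarPartition P
    open ≡-Reasoning

  seidel-same-colour : ∀ {x y} → x ≢ y → χ x ≡ χ y → a' x y ≡ adj G x y
  seidel-same-colour {x} {y} x≢y χx≡χy = begin
    a' x y                       ≡⟨ switched x y x≢y ⟩
    adj G x y xor (χ x xor χ y)  ≡⟨ cong (λ b → adj G x y xor (b xor χ y)) χx≡χy ⟩
    adj G x y xor (χ y xor χ y)  ≡⟨ cong (adj G x y xor_) (xor-same (χ y)) ⟩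
    adj G x y xor false          ≡⟨ xor-identityʳ (adj G x y) ⟩
    adj G x y                    ∎
    where open ≡-Reasoning

  seidel-P4 : ∀ {a'-sym a'-irrefl a b c d} →
              χ a ≡ χ b → χ b ≡ χ c → χ c ≡ χ d →
              IsInducedP4 (on-vertices-of G a' a'-sym a'-irrefl) a b c d →
              IsInducedP4 G a b c d
  seidel-P4 χab χbc χcd (a≢b , a≢c , a≢d , b≢c , b≢d , c≢d , eab , ebc , ecd , eac , ebd , ead) =
    a≢b , a≢c , a≢d , b≢c , b≢d , c≢d ,
    unswitch a≢b χab eab , unswitch b≢c χbc ebc , unswitch c≢d χcd ecd ,
    unswitch a≢c (trans χab χbc) eac , unswitch b≢d (trans χbc χcd) ebd ,
    unswitch a≢d (trans χab (trans χbc χcd)) ead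
    where
    unswitch : ∀ {x y e} → x ≢ y → χ x ≡ χ y → a' x y ≡ e → adj G x y ≡ e
    unswitch x≢y χx≡χy e = trans (sym (seidel-same-colour x≢y χx≡χy)) e

complement-adj : ∀ {m} → (Fin m → Fin m → Bool) → Fin m → Fin m → Bool
complement-adj a x y = if ⌊ x ≟ y ⌋ then false else not (a x y)

complement : Graph → Graph
complement G = on-vertices-of G (complement-adj (adj G)) symmetric irreflexive
  where
  symmetric : ∀ x y → complement-adj (adj G) x y ≡ complement-adj (adj G) y x
  symmetric x y with x ≟ y | y ≟ x
  ... | yes _   | yes _   = refl
  ... | yes x≡y | no y≢x  = contradiction (sym x≡y) y≢x
  ... | no x≢y  | yes y≡x = contradiction (sym y≡x) x≢y
  ... | no _    | no _    = cong not (adj-sym G x y)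
  irreflexive : ∀ x → complement-adj (adj G) x x ≡ false
  irreflexive x with x ≟ x
  ... | yes _  = refl
  ... | no x≢x = contradiction refl x≢x

module _ (G : Graph) where

  uncomplement : ∀ {x y e} → x ≢ y → adj (complement G) x y ≡ e → adj G x y ≡ not e
  uncomplement x≢y e = not-move (trans (sym (off-diagonal x≢y)) e)

  complement-polar : TwoPolar G → TwoPolar (complement G)
  complement-polar P = record
    { side = λ x → not (side x)
    ; p    = q
    ; q    = p
    ; A-ok = λ x y x≢y sx sy → begin
        adj (complement G) x y   ≡⟨ off-diagonal x≢y ⟩
        not (adj G x y)          ≡⟨ cong not (B-ok x y x≢y (not-move sx) (not-move sy)) ⟩
        not (not (q x xor q y))  ≡⟨ not-involutive (q x xor q y) ⟩
        q x xor q y              ∎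
    ; B-ok = λ x y x≢y sx sy → begin
        adj (complement G) x y   ≡⟨ off-diagonal x≢y ⟩
        not (adj G x y)          ≡⟨ cong not (A-ok x y x≢y (not-move sx) (not-move sy)) ⟩
        not (p x xor p y)        ∎
    }
    where
    open TwoPolarPartition P
    open ≡-Reasoning

  -- P4 is self-complementary: an induced P4 a-b-c-d of the complement is the
  -- induced P4 c-a-d-b of G.  Hence the complement of a cograph is a cograph.
  complement-cograph : Cograph G → Cograph (complement G)
  complement-cograph noP4 a b c d
    (a≢b , a≢c , a≢d , b≢c , b≢d , c≢d , eab , ebc , ecd , eac , ebd , ead) =
    noP4 c a d b
      ( ≢-sym a≢c , c≢d , ≢-sym b≢c , a≢d , a≢b , ≢-sym b≢d
      , trans (adj-sym G c a) (uncomplement a≢c eac)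
      , uncomplement a≢d ead
      , trans (adj-sym G d b) (uncomplement b≢d ebd)
      , uncomplement c≢d ecd
      , uncomplement a≢b eab
      , trans (adj-sym G c b) (uncomplement b≢c ebc) )

EdgeInvariant : (G : Graph) → (Fin (n G) → Bool) → Set
EdgeInvariant G f = ∀ x y → adj G x y ≡ true → f x ≡ f y

invariant-along-paths : ∀ {G f x y} → EdgeInvariant G f → Reachable G x y → f x ≡ f y
invariant-along-paths inv here           = refl
invariant-along-paths inv (step xz path) = trans (inv _ _ xz) (invariant-along-paths inv path)

two-coloured-disconnected : ∀ {G f x y} → EdgeInvariant G f → f x ≡ true → f y ≡ false →
                            Disconnected G
two-coloured-disconnected {x = x} {y} inv fx fy =
  x , y , λ path → contradiction (trans (sym fx) (trans (invariant-along-paths inv path) fy)) λ ()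

switch-is-seidel : (H : Graph) (v : Fin (n H)) →
                   SeidelSwitch H (λ x → ⌊ x ≟ v ⌋) (adj (switch H v))
switch-is-seidel H v x y x≢y =
  trans (off-diagonal x≢y)
    (trans (flip-if (⌊ x ≟ v ⌋ ∨ ⌊ y ≟ v ⌋) (adj H x y))
      (cong (adj H x y xor_) at-most-one-is-v))
  where
  -- x and y are distinct, so at most one of them is v.
  at-most-one-is-v : ⌊ x ≟ v ⌋ ∨ ⌊ y ≟ v ⌋ ≡ ⌊ x ≟ v ⌋ xor ⌊ y ≟ v ⌋
  at-most-one-is-v with x ≟ v | y ≟ v
  ... | yes x≡v | yes y≡v = contradiction (trans x≡v (sym y≡v)) x≢y
  ... | yes _   | no _    = refl
  ... | no _    | yes _   = refl
  ... | no _    | no _    = refl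

module _ (H : Graph) (s : ComponentSplit H) where

  private
    PC : Graph
    PC = partialComplement H s

  no-edges-between-groups : ∀ {x y} → g s x xor g s y ≡ true → adj H x y ≡ false
  no-edges-between-groups {x} {y} different with adj H x y in xy
  ... | false = refl
  ... | true  = contradiction
    (trans (sym different) (trans (cong (_xor g s y) (closed s x y xy)) (xor-same (g s y))))
    λ ()

  -- Inside a group the partial complement is the complement of H; between
  -- groups it has no edges, which H also lacks.
  within-groups-complemented : ∀ x y →
    (if g s x xor g s y then false else not (adj H x y))
      ≡ not (adj H x y) xor (g s x xor g s y)
  within-groups-complemented x y with g s x xor g s y in different
  ... | false = sym (xor-identityʳ (not (adj H x y)))
  ... | true  rewrite no-edges-between-groups different = refl

  partialComplement-is-seidel : SeidelSwitch (complement H) (g s) (adj PC)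
  partialComplement-is-seidel x y x≢y = begin
    adj PC x y                                     ≡⟨ off-diagonal x≢y ⟩
    (if g s x xor g s y then false else not (adj H x y)) ≡⟨ within-groups-complemented x y ⟩
    not (adj H x y) xor (g s x xor g s y)          ≡⟨ cong (_xor (g s x xor g s y)) (sym (off-diagonal x≢y)) ⟩
    adj (complement H) x y xor (g s x xor g s y)   ∎
    where open ≡-Reasoning

  edges-within-groups : EdgeInvariant PC (g s)
  edges-within-groups x y xy with x ≟ y | g s x | g s y
  ... | yes _ | _     | _     = contradiction xy λ ()
  ... | no _  | true  | true  = refl
  ... | no _  | false | false = refl
  ... | no _  | true  | false = contradiction xy λ ()
  ... | no _  | false | true  = contradiction xy λ ()

  partialComplement-polar : TwoPolar H → TwoPolar PC
  partialComplement-polar P =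
    seidel-polar (complement H) (g s) partialComplement-is-seidel (complement-polar H P)

  -- An induced P4 of the partial complement is connected, so lies inside one
  -- group; there the partial complement agrees with the complement of H,
  -- which is a cograph.
  partialComplement-cograph : Cograph H → Cograph PC
  partialComplement-cograph noP4 a b c d p4@(_ , _ , _ , _ , _ , _ , eab , ebc , ecd , _) =
    complement-cograph H noP4 a b c d
      (seidel-P4 (complement H) (g s) partialComplement-is-seidel
        {adj-sym PC} {adj-irrefl PC}
        (edges-within-groups a b eab) (edges-within-groups b c ebc)
        (edges-within-groups c d ecd) p4)

  partialComplement-disconnected : Disconnected PC
  partialComplement-disconnected =
    two-coloured-disconnected edges-within-groups
      (proj₂ (nonempty₁ s)) (proj₂ (nonempty₂ s))

-- Switching is a Seidel switch; each property of a partial complement was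
-- established above (the split s alone is used, not the disconnectedness of H).
mainTheorem4 : (H : Graph) → TwoPolar H →
    ((v : Fin (Graph.n H)) → TwoPolar (switch H v))
    × (Cograph H → Disconnected H → (s : ComponentSplit H) →
        TwoPolar (partialComplement H s)
        × Cograph (partialComplement H s)
        × Disconnected (partialComplement H s))
mainTheorem4 H P =
  (λ v → seidel-polar H (λ x → ⌊ x ≟ v ⌋) (switch-is-seidel H v) P) ,
  λ cograph _ s →
    partialComplement-polar H s P ,
    partialComplement-cograph H s cograph ,
    partialComplement-disconnected H s
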